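{- Let $n\geq 1$ and let $G$ be a neat multigraph with vertex set $[n]$. Then $G\in NC(n)$ if and only if the graph $\tilde G$ is a forest.
   Context: A multigraph is $(V,w)$ with $w:\binom V2\to\mathbb{N}$; $\mu(G)=\max w$. An $(s,q)$-graph is one in which every $s$ vertices span total multiplicity at most $q$; $F(n,s,q)$ is the set of $(s,q)$-graphs on $[n]$. $D(n)=\{G\in F(n,4,15):\mu(G)\le 3\}\cap F(n,3,8)$. An $(i,j,k)$-triangle is a 3-set of vertices whose multiset of pair multiplicities is $\{i,j,k\}$. $C(n)$ is the set of $G\in D(n)$ with no $(3,1,1)$-, $(2,1,1)$- or $(3,2,1)$-triangle. For $t\ge3$, $C_t(3,2)=([t],w)$ with $w(12)=w(23)=\dots=w((t-1)t)=w(t1)=3$ and $w=2$ on all other pairs. $NC(n)$ is the set of $G\in C(n)$ having no induced submultigraph isomorphic to $C_t(3,2)$ for any $t\ge3$. $G$ is neat if $\mu(G)\le3$ and $G$ has no $(1,1,2)$-, $(1,1,3)$- or $(1,2,3)$-triangle. For neat $G$, the relation $x\sim y\iff x=y$ or $w(xy)=1$ is an equivalence relation, and between two distinct classes $V_i,V_j$ all pairs have a common multiplicity $w_{ij}\in\{2,3\}$; $\tilde G$ is the graph whose vertices are the equivalence classes, with $V_iV_j$ an edge iff $w_{ij}=3$.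
   Formalization: Neatness also includes w(xy) ≥ 1 for all distinct vertices x, y, so every pair multiplicity of a neat multigraph lies in {1,2,3} rather than in ℕ. The statement above fails without it. -}

module Defs where

open import Data.Nat using (ℕ; zero; suc; _+_; _≤_; _<_; _%_)
open import Data.Fin using (Fin; toℕ) renaming (zero to fz; suc to fs)
open import Data.Product using (Σ; _×_; _,_; ∃)
open import Data.Sum using (_⊎_)
open import Relation.Nullary using (¬_)
open import Relation.Binary.PropositionalEquality using (_≡_; _≢_)
open import Function.Definitions using (Injective)

-- A multigraph on [n] = Fin n: a symmetric multiplicity function on pairs.
-- Values on the diagonal are irrelevant (never used).
record Multigraph (n : ℕ) : Set where
  field
    w   : Fin n → Fin n → ℕ
    sym : ∀ x y → w x y ≡ w y x
open Multigraph public

sumFin : (s : ℕ) → (Fin s → ℕ) → ℕ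
sumFin zero    f = 0
sumFin (suc s) f = f fz + sumFin s (λ i → f (fs i))

pairSum : (s : ℕ) → (Fin s → Fin s → ℕ) → ℕ
pairSum zero    g = 0
pairSum (suc s) g = sumFin s (λ j → g fz (fs j)) + pairSum s (λ i j → g (fs i) (fs j))

-- (s,q)-graph: every s vertices span total multiplicity at most q.
-- An s-set of vertices is given by an injective map Fin s → Fin n.
IsSQ : ∀ {n} → ℕ → ℕ → Multigraph n → Set
IsSQ {n} s q G = (S : Fin s → Fin n) → Injective _≡_ _≡_ S →
  pairSum s (λ i j → w G (S i) (S j)) ≤ q

MuLe : ∀ {n} → ℕ → Multigraph n → Set
MuLe {n} m G = (x y : Fin n) → x ≢ y → w G x y ≤ m

-- G has an (i,j,k)-triangle: a 3-set {a,b,c} whose multiset of pair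
-- multiplicities is {i,j,k}; since a,b,c range over all orderings, this is
-- equivalent to some ordering realising (w ab, w bc, w ca) = (i, j, k).
HasTriangle : ∀ {n} → Multigraph n → ℕ → ℕ → ℕ → Set
HasTriangle {n} G i j k = Σ (Fin n) λ a → Σ (Fin n) λ b → Σ (Fin n) λ c →
  (a ≢ b) × (b ≢ c) × (a ≢ c) ×
  (w G a b ≡ i) × (w G b c ≡ j) × (w G c a ≡ k)

InD : ∀ {n} → Multigraph n → Set
InD G = IsSQ 4 15 G × MuLe 3 G × IsSQ 3 8 G

InC : ∀ {n} → Multigraph n → Set
InC G = InD G × ¬ HasTriangle G 3 1 1 × ¬ HasTriangle G 2 1 1 × ¬ HasTriangle G 3 2 1

CAdj : (k : ℕ) → Fin (3 + k) → Fin (3 + k) → Set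
CAdj k i j = (suc (toℕ i) % (3 + k) ≡ toℕ j) ⊎ (suc (toℕ j) % (3 + k) ≡ toℕ i)

data CtW (k : ℕ) (i j : Fin (3 + k)) : ℕ → Set where
  three : CAdj k i j → CtW k i j 3
  two   : ¬ CAdj k i j → CtW k i j 2

-- G has an induced submultigraph isomorphic to C_t(3,2), t = k + 3:
-- an injective f : [t] → V(G) with w(f i, f j) equal to the C_t(3,2)
-- multiplicity of ij for all i ≠ j.
HasInducedCt : ∀ {n} → Multigraph n → ℕ → Set
HasInducedCt {n} G k = Σ (Fin (3 + k) → Fin n) λ f → Injective _≡_ _≡_ f ×
  ((i j : Fin (3 + k)) → i ≢ j → CtW k i j (w G (f i) (f j)))

InNC : ∀ {n} → Multigraph n → Set
InNC G = InC G × ((k : ℕ) → ¬ HasInducedCt G k)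

Neat : ∀ {n} → Multigraph n → Set
Neat {n} G = ((x y : Fin n) → x ≢ y → 1 ≤ w G x y) × MuLe 3 G ×
  ¬ HasTriangle G 1 1 2 × ¬ HasTriangle G 1 1 3 × ¬ HasTriangle G 1 2 3

Sim : ∀ {n} → Multigraph n → Fin n → Fin n → Set
Sim G x y = (x ≡ y) ⊎ (w G x y ≡ 1)

-- Edge of G̃ between the classes of x and y (well defined for neat G).
TEdge : ∀ {n} → Multigraph n → Fin n → Fin n → Set
TEdge G x y = w G x y ≡ 3

-- A cycle of length t = k + 3 in G̃: t pairwise distinct classes, given by
-- representatives f i (pairwise non-equivalent), cyclically adjacent in G̃.
HasTildeCycle : ∀ {n} → Multigraph n → Set
HasTildeCycle {n} G = Σ ℕ λ k → Σ (Fin (3 + k) → Fin n) λ f →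
  ((i j : Fin (3 + k)) → i ≢ j → ¬ Sim G (f i) (f j)) ×
  ((i j : Fin (3 + k)) → CAdj k i j → TEdge G (f i) (f j))

TildeForest : ∀ {n} → Multigraph n → Set
TildeForest G = ¬ HasTildeCycle G

-- Forward: a cycle of G̃ of minimal length has no chord, so its representatives
-- span a copy of C_t(3,2): consecutive pairs have multiplicity 3, and any other
-- pair is neither 1 (distinct classes) nor 3 (no chord), hence 2.
-- Backward: a copy of C_t(3,2) is itself a cycle of G̃. The three forbidden
-- triangles of C(n) are rotations or reflections of the ones neatness forbids.
-- Three vertices have multiplicity at most 3 + 3 + 2, since three 3s would be a
-- triangle of G̃. Four vertices split into three perfect matchings of two pairs
-- each; a matching of two 3s leaves at most 9 for the other two, because a 3 in
-- each of them closes a triangle with it, and if one of them is again a pair of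
-- 3s the two form a 4-cycle of G̃ whose diagonals must contain a 1.
module Submission where

open import Defs
open import Data.Nat using (ℕ; _≤_)
open import Function.Bundles using (_⇔_)

open import Data.Fin.Base using (Fin; toℕ)
open import Data.Fin.Patterns using (0F; 1F; 2F; 3F)
open import Data.Fin.Properties using (toℕ<n; toℕ-injective; toℕ-fromℕ<; any?)
  renaming (_≟_ to _≟ᶠ_)
open import Data.Nat.Base using (zero; suc; _+_; _∸_; _<_; _%_; NonZero; z≤n; s≤s; s≤s⁻¹)
open import Data.Nat.DivMod using (_mod_; m<n⇒m%n≡m; n%n≡0)
open import Data.Nat.Induction using (<-rec)
open import Data.Nat.Properties
  using (_≟_; _≤?_; ≤-trans; <⇒≤; n<1+n; <-≤-trans; ≤∧≢⇒<; ≰⇒>; <-cmp; 1+n≢n; suc-injective; m≤n+m; m≤n⇒m<n∨m≡n;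
         +-mono-≤; +-monoʳ-<; +-suc; +-identityʳ; +-comm; +-cancelˡ-≡; m+[n∸m]≡n;
         +-commutativeSemigroup)
open import Algebra.Properties.CommutativeSemigroup +-commutativeSemigroup using (x∙yz≈y∙xz; x∙yz≈y∙zx)
open import Data.Nat.Tactic.RingSolver using (solve-∀)
open import Data.Product using (∃; ∃₂; _×_; _,_)
open import Data.Sum using (_⊎_; inj₁; inj₂)
import Data.Sum as ⊎
open import Function.Base using (_∘_)
open import Function.Bundles using (mk⇔)
open import Function.Definitions using (Injective)
open import Relation.Binary.Definitions using (tri<; tri≈; tri>)
open import Relation.Binary.PropositionalEquality
  using (_≡_; _≢_; refl; trans; cong; subst; subst₂; ≢-sym)
import Relation.Binary.PropositionalEquality as ≡
open import Relation.Nullary using (¬_; Dec; yes; no; contradiction)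
open import Relation.Nullary.Decidable using (_×-dec_; _⊎-dec_; ¬?; decidable-stable)

≤3∧≢3⇒≤2 : ∀ {m} → m ≤ 3 → m ≢ 3 → m ≤ 2
≤3∧≢3⇒≤2 m≤3 m≢3 = s≤s⁻¹ (≤∧≢⇒< m≤3 m≢3)

≥1∧≤3∧≢1∧≢3⇒≡2 : ∀ {m} → 1 ≤ m → m ≤ 3 → m ≢ 1 → m ≢ 3 → m ≡ 2
≥1∧≤3∧≢1∧≢3⇒≡2 {1} _ _ m≢1 _ = contradiction refl m≢1
≥1∧≤3∧≢1∧≢3⇒≡2 {2} _ _ _ _ = refl
≥1∧≤3∧≢1∧≢3⇒≡2 {3} _ _ _ m≢3 = contradiction refl m≢3
≥1∧≤3∧≢1∧≢3⇒≡2 {suc (suc (suc (suc _)))} _ (s≤s (s≤s (s≤s ()))) _ _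

+≤5 : ∀ {a b} → a ≤ 3 → b ≤ 3 → ¬ (a ≡ 3 × b ≡ 3) → a + b ≤ 5
+≤5 {a} {b} a≤3 b≤3 notBoth with a ≟ 3 | b ≟ 3
... | no a≢3  | _       = +-mono-≤ (≤3∧≢3⇒≤2 a≤3 a≢3) b≤3
... | yes _   | no b≢3  = +-mono-≤ a≤3 (≤3∧≢3⇒≤2 b≤3 b≢3)
... | yes a≡3 | yes b≡3 = contradiction (a≡3 , b≡3) notBoth

+≤4 : ∀ {a b} → a ≤ 3 → b ≤ 3 → a ≢ 3 → b ≢ 3 → a + b ≤ 4
+≤4 a≤3 b≤3 a≢3 b≢3 = +-mono-≤ (≤3∧≢3⇒≤2 a≤3 a≢3) (≤3∧≢3⇒≤2 b≤3 b≢3)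

+≤3 : ∀ {a b} → a ≤ 3 → b ≤ 3 → a ≢ 3 → b ≢ 3 → ¬ (2 ≤ a × 2 ≤ b) → a + b ≤ 3
+≤3 {a} {b} a≤3 b≤3 a≢3 b≢3 notBoth with 2 ≤? a | 2 ≤? b
... | no 2≰a  | _       = +-mono-≤ (s≤s⁻¹ (≰⇒> 2≰a)) (≤3∧≢3⇒≤2 b≤3 b≢3)
... | yes _   | no 2≰b  = +-mono-≤ (≤3∧≢3⇒≤2 a≤3 a≢3) (s≤s⁻¹ (≰⇒> 2≰b))
... | yes 2≤a | yes 2≤b = contradiction (2≤a , 2≤b) notBoth

+-+≤8 : ∀ {a b c} → a ≤ 3 → b ≤ 3 → c ≤ 3 → ¬ (a ≡ 3 × b ≡ 3 × c ≡ 3) → a + b + c ≤ 8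
+-+≤8 {a} {b} a≤3 b≤3 c≤3 notAll with (a ≟ 3) ×-dec (b ≟ 3)
... | no notBoth       = +-mono-≤ (+≤5 a≤3 b≤3 notBoth) c≤3
... | yes (a≡3 , b≡3) = +-mono-≤ (+-mono-≤ a≤3 b≤3) (≤3∧≢3⇒≤2 c≤3 λ c≡3 → notAll (a≡3 , b≡3 , c≡3))

+-+≤9 : ∀ {a b c d} → a ≤ 3 → b ≤ 3 → a ≢ 3 → b ≢ 3 → c ≤ 3 → d ≤ 3 →
  (c ≡ 3 × d ≡ 3 → ¬ (2 ≤ a × 2 ≤ b)) → (a + b) + (c + d) ≤ 9
+-+≤9 {c = c} {d} a≤3 b≤3 a≢3 b≢3 c≤3 d≤3 thin with (c ≟ 3) ×-dec (d ≟ 3)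
... | yes both   = +-mono-≤ (+≤3 a≤3 b≤3 a≢3 b≢3 (thin both)) (+-mono-≤ c≤3 d≤3)
... | no notBoth = +-mono-≤ (+≤4 a≤3 b≤3 a≢3 b≢3) (+≤5 c≤3 d≤3 notBoth)

pairSum-3 : ∀ g → pairSum 3 g ≡ g 0F 1F + g 0F 2F + g 1F 2F
pairSum-3 g = regroup (g 0F 1F) (g 0F 2F) (g 1F 2F)
  where
  regroup : ∀ a b c → (a + (b + 0)) + ((c + 0) + 0) ≡ a + b + c
  regroup = solve-∀

pairSum-4 : ∀ g → pairSum 4 g ≡ (g 0F 1F + g 2F 3F) + ((g 0F 2F + g 1F 3F) + (g 0F 3F + g 1F 2F))
pairSum-4 g = regroup (g 0F 1F) (g 0F 2F) (g 0F 3F) (g 1F 2F) (g 1F 3F) (g 2F 3F)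
  where
  regroup : ∀ a b c d e f → (a + (b + (c + 0))) + ((d + (e + 0)) + ((f + 0) + 0)) ≡ (a + f) + ((b + e) + (c + d))
  regroup = solve-∀

suc-% : ∀ {m t} .{{_ : NonZero t}} → m < t → (suc m < t × suc m % t ≡ suc m) ⊎ (suc m ≡ t × suc m % t ≡ 0)
suc-% m<t with m≤n⇒m<n∨m≡n m<t
... | inj₁ 1+m<t = inj₁ (1+m<t , m<n⇒m%n≡m 1+m<t)
... | inj₂ refl  = inj₂ (refl , n%n≡0 _)

suc-%-≢ : ∀ {k m} → m < 3 + k → suc m % (3 + k) ≢ m
suc-%-≢ m<t eq with suc-% m<t
... | inj₁ (_ , 1+m%≡1+m)   = 1+n≢n (trans (≡.sym 1+m%≡1+m) eq)
... | inj₂ (1+m≡t , 1+m%≡0) = contradiction (trans (cong suc (trans (≡.sym 1+m%≡0) eq)) 1+m≡t) λ ()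

CAdj⇒≢ : ∀ {k} {i j : Fin (3 + k)} → CAdj k i j → i ≢ j
CAdj⇒≢ {i = i} (inj₁ eq) refl = suc-%-≢ (toℕ<n i) eq
CAdj⇒≢ {i = i} (inj₂ eq) refl = suc-%-≢ (toℕ<n i) eq

CAdj? : ∀ k (i j : Fin (3 + k)) → Dec (CAdj k i j)
CAdj? k i j = (suc (toℕ i) % (3 + k) ≟ toℕ j) ⊎-dec (suc (toℕ j) % (3 + k) ≟ toℕ i)

gap<k : ∀ m {k′ k} → m + (2 + k′) < 3 + k → ¬ (m ≡ 0 × 2 + k′ ≡ 2 + k) → k′ < k
gap<k zero    {k′} lt notWrap = ≤∧≢⇒< (s≤s⁻¹ (s≤s⁻¹ (s≤s⁻¹ lt))) λ k′≡k → notWrap (refl , cong (2 +_) k′≡k)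
gap<k (suc m) {k′} lt _       = s≤s⁻¹ (≤-trans (m≤n+m (2 + k′) m) (s≤s⁻¹ (s≤s⁻¹ lt)))

-- Two positions of a (3 + k)-cycle that are not cyclically adjacent cut off an
-- arc which, closed by the pair itself, is a strictly shorter cycle.
nonadjacent-gap : ∀ {k} (i j : Fin (3 + k)) → toℕ i < toℕ j → ¬ CAdj k i j →
  ∃ λ k′ → k′ < k × toℕ j ≡ toℕ i + (2 + k′)
nonadjacent-gap {k} i j i<j nonadj = k′ , gap<k (toℕ i) (subst (_< 3 + k) j≡ (toℕ<n j)) notWrap , j≡
  where
  1+i≢j : suc (toℕ i) ≢ toℕ j
  1+i≢j 1+i≡j = nonadj (inj₁ (trans (m<n⇒m%n≡m (subst (_< 3 + k) (≡.sym 1+i≡j) (toℕ<n j))) 1+i≡j))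
  k′ : ℕ
  k′ = toℕ j ∸ (2 + toℕ i)
  shift : ∀ a x → 2 + a + x ≡ a + (2 + x)
  shift = solve-∀
  j≡ : toℕ j ≡ toℕ i + (2 + k′)
  j≡ = trans (≡.sym (m+[n∸m]≡n (≤∧≢⇒< i<j 1+i≢j))) (shift (toℕ i) k′)
  notWrap : ¬ (toℕ i ≡ 0 × 2 + k′ ≡ 2 + k)
  notWrap (i≡0 , gap≡) =
    nonadj (inj₂ (trans (cong (λ x → suc x % (3 + k)) j≡2+k) (trans (n%n≡0 (3 + k)) (≡.sym i≡0))))
    where
    j≡2+k : toℕ j ≡ 2 + k
    j≡2+k = trans j≡ (trans (cong (_+ (2 + k′)) i≡0) gap≡)

toℕ-mod : ∀ {m t} .{{_ : NonZero t}} → m < t → toℕ (m mod t) ≡ m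
toℕ-mod m<t = trans (toℕ-fromℕ< _) (m<n⇒m%n≡m m<t)

CtW⇒2≤ : ∀ {k i j m} → CtW k i j m → 2 ≤ m
CtW⇒2≤ (three _) = s≤s (s≤s z≤n)
CtW⇒2≤ (two _)   = s≤s (s≤s z≤n)

CtW-adjacent : ∀ {k i j m} → CtW k i j m → CAdj k i j → m ≡ 3
CtW-adjacent (three _)   _   = refl
CtW-adjacent (two nonadj) adj = contradiction adj nonadj

record Distinct₄ {n} (a b c d : Fin n) : Set where
  field
    a≢b : a ≢ b
    a≢c : a ≢ c
    a≢d : a ≢ d
    b≢c : b ≢ c
    b≢d : b ≢ d
    c≢d : c ≢ d

swap-last : ∀ {n} {a b c d : Fin n} → Distinct₄ a b c d → Distinct₄ a b d c
swap-last δ = record { a≢b = a≢b ; a≢c = a≢d ; a≢d = a≢c ; b≢c = b≢d ; b≢d = b≢c ; c≢d = ≢-sym c≢d }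
  where open Distinct₄ δ

swap-middle : ∀ {n} {a b c d : Fin n} → Distinct₄ a b c d → Distinct₄ a c b d
swap-middle δ = record { a≢b = a≢c ; a≢c = a≢b ; a≢d = a≢d ; b≢c = ≢-sym b≢c ; b≢d = c≢d ; c≢d = b≢d }
  where open Distinct₄ δ

module _ {n : ℕ} (G : Multigraph n) where

  TEdge-sym : ∀ {x y} → TEdge G x y → TEdge G y x
  TEdge-sym {x} {y} = trans (sym G y x)

  Sim-sym : ∀ {x y} → Sim G x y → Sim G y x
  Sim-sym (inj₁ x≡y) = inj₁ (≡.sym x≡y)
  Sim-sym {x} {y} (inj₂ w≡1) = inj₂ (trans (sym G y x) w≡1)

  ≢∧2≤⇒≁ : ∀ {x y} → x ≢ y → 2 ≤ w G x y → ¬ Sim G x y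
  ≢∧2≤⇒≁ x≢y _ (inj₁ x≡y) = x≢y x≡y
  ≢∧2≤⇒≁ _ 2≤w (inj₂ w≡1) with subst (2 ≤_) w≡1 2≤w
  ... | s≤s ()

  TEdge⇒2≤ : ∀ {x y} → TEdge G x y → 2 ≤ w G x y
  TEdge⇒2≤ e = subst (2 ≤_) (≡.sym e) (s≤s (s≤s z≤n))

  ≢∧TEdge⇒≁ : ∀ {x y} → x ≢ y → TEdge G x y → ¬ Sim G x y
  ≢∧TEdge⇒≁ x≢y = ≢∧2≤⇒≁ x≢y ∘ TEdge⇒2≤

  HasTriangle-rotate : ∀ {i j k} → HasTriangle G i j k → HasTriangle G j k i
  HasTriangle-rotate (a , b , c , a≢b , b≢c , a≢c , ab , bc , ca) =
    b , c , a , b≢c , ≢-sym a≢c , ≢-sym a≢b , bc , ca , ab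

  HasTriangle-reverse : ∀ {i j k} → HasTriangle G i j k → HasTriangle G k j i
  HasTriangle-reverse (a , b , c , a≢b , b≢c , a≢c , ab , bc , ca) =
    a , c , b , a≢c , ≢-sym b≢c , a≢b , trans (sym G a c) ca , trans (sym G c b) bc , trans (sym G b a) ab

  -- Positions are natural numbers, so that shifting an arc of a cycle is again
  -- a cycle; only the positions 0 … 2 + k are constrained.
  record Cycle (k : ℕ) : Set where
    field
      vertex    : ℕ → Fin n
      separated : ∀ {i j} → i < 3 + k → j < 3 + k → i ≢ j → ¬ Sim G (vertex i) (vertex j)
      step      : ∀ {i} → suc i < 3 + k → TEdge G (vertex i) (vertex (suc i))
      close     : TEdge G (vertex (2 + k)) (vertex 0)

  open Cycle

  separated-from-< : ∀ {t} (v : ℕ → Fin n) → (∀ {i j} → i < j → j < t → ¬ Sim G (v i) (v j)) →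
    ∀ {i j} → i < t → j < t → i ≢ j → ¬ Sim G (v i) (v j)
  separated-from-< v sep {i} {j} i<t j<t i≢j with <-cmp i j
  ... | tri< i<j _ _ = sep i<j j<t
  ... | tri≈ _ i≡j _ = contradiction i≡j i≢j
  ... | tri> _ _ j<i = sep j<i i<t ∘ Sim-sym

  cycle-edge : ∀ {k} (c : Cycle k) (i j : Fin (3 + k)) → CAdj k i j →
    TEdge G (vertex c (toℕ i)) (vertex c (toℕ j))
  cycle-edge {k} c i j (inj₁ eq) = successor-edge i j eq
    where
    successor-edge : ∀ i j → suc (toℕ i) % (3 + k) ≡ toℕ j → TEdge G (vertex c (toℕ i)) (vertex c (toℕ j))
    successor-edge i j eq with suc-% (toℕ<n i)
    ... | inj₁ (1+i<t , 1+i%≡1+i) =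
      subst (λ l → TEdge G (vertex c (toℕ i)) (vertex c l)) (trans (≡.sym 1+i%≡1+i) eq) (step c 1+i<t)
    ... | inj₂ (1+i≡t , 1+i%≡0) =
      subst₂ (λ a b → TEdge G (vertex c a) (vertex c b))
        (≡.sym (suc-injective 1+i≡t)) (trans (≡.sym 1+i%≡0) eq) (close c)
  cycle-edge c i j (inj₂ eq) = TEdge-sym (cycle-edge c j i (inj₁ eq))

  toTildeCycle : ∀ {k} → Cycle k → HasTildeCycle G
  toTildeCycle {k} c = k , vertex c ∘ toℕ ,
    (λ i j i≢j → separated c (toℕ<n i) (toℕ<n j) (i≢j ∘ toℕ-injective)) , cycle-edge c

  fromTildeCycle : HasTildeCycle G → ∃ Cycle
  fromTildeCycle (k , f , apart , edge) = k , record
    { vertex    = v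
    ; separated = λ i<t j<t i≢j → apart _ _ λ eq →
        i≢j (trans (≡.sym (toℕ-mod i<t)) (trans (cong toℕ eq) (toℕ-mod j<t)))
    ; step      = λ {i} 1+i<t → edge _ _ (inj₁
        (trans (cong (λ x → suc x % (3 + k)) (toℕ-mod (<⇒≤ 1+i<t)))
          (trans (m<n⇒m%n≡m 1+i<t) (≡.sym (toℕ-mod 1+i<t)))))
    ; close     = edge _ _ (inj₁
        (trans (cong (λ x → suc x % (3 + k)) (toℕ-mod {2 + k} {3 + k} (n<1+n (2 + k))))
          (trans (n%n≡0 (3 + k)) (≡.sym (toℕ-mod {0} {3 + k} (s≤s z≤n))))))
    }
    where
    v : ℕ → Fin n
    v m = f (m mod (3 + k))

  tildeTriangle : ∀ {a b c} → a ≢ b → b ≢ c → a ≢ c →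
    TEdge G a b → TEdge G b c → TEdge G c a → HasTildeCycle G
  tildeTriangle {a} {b} {c} a≢b b≢c a≢c ab bc ca = toTildeCycle {0} record
    { vertex = v ; separated = separated-from-< v sep ; step = st ; close = ca }
    where
    v : ℕ → Fin n
    v 0 = a
    v 1 = b
    v _ = c
    sep : ∀ {i j} → i < j → j < 3 → ¬ Sim G (v i) (v j)
    sep {0} {1} _ _ = ≢∧TEdge⇒≁ a≢b ab
    sep {0} {2} _ _ = ≢∧TEdge⇒≁ a≢c (TEdge-sym ca)
    sep {1} {2} _ _ = ≢∧TEdge⇒≁ b≢c bc
    sep {_} {0} ()
    sep {suc _} {1} (s≤s ())
    sep {suc (suc _)} {2} (s≤s (s≤s ()))
    sep {_} {suc (suc (suc _))} _ (s≤s (s≤s (s≤s ())))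
    st : ∀ {i} → suc i < 3 → TEdge G (v i) (v (suc i))
    st {0} _ = ab
    st {1} _ = bc
    st {suc (suc _)} (s≤s (s≤s (s≤s ())))

  tildeSquare : ∀ {a b c d} → Distinct₄ a b c d →
    TEdge G a b → TEdge G b c → TEdge G c d → TEdge G d a →
    2 ≤ w G a c → 2 ≤ w G b d → HasTildeCycle G
  tildeSquare {a} {b} {c} {d} δ ab bc cd da 2≤ac 2≤bd = toTildeCycle {1} record
    { vertex = v ; separated = separated-from-< v sep ; step = st ; close = da }
    where
    open Distinct₄ δ
    v : ℕ → Fin n
    v 0 = a
    v 1 = b
    v 2 = c
    v _ = d
    sep : ∀ {i j} → i < j → j < 4 → ¬ Sim G (v i) (v j)
    sep {0} {1} _ _ = ≢∧TEdge⇒≁ a≢b ab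
    sep {0} {2} _ _ = ≢∧2≤⇒≁ a≢c 2≤ac
    sep {0} {3} _ _ = ≢∧TEdge⇒≁ a≢d (TEdge-sym da)
    sep {1} {2} _ _ = ≢∧TEdge⇒≁ b≢c bc
    sep {1} {3} _ _ = ≢∧2≤⇒≁ b≢d 2≤bd
    sep {2} {3} _ _ = ≢∧TEdge⇒≁ c≢d cd
    sep {_} {0} ()
    sep {suc _} {1} (s≤s ())
    sep {suc (suc _)} {2} (s≤s (s≤s ()))
    sep {suc (suc (suc _))} {3} (s≤s (s≤s (s≤s ())))
    sep {_} {suc (suc (suc (suc _)))} _ (s≤s (s≤s (s≤s (s≤s ()))))
    st : ∀ {i} → suc i < 4 → TEdge G (v i) (v (suc i))
    st {0} _ = ab
    st {1} _ = bc
    st {2} _ = cd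
    st {suc (suc (suc _))} (s≤s (s≤s (s≤s (s≤s ()))))

  inducedCt⇒tildeCycle : ∀ {k} → HasInducedCt G k → HasTildeCycle G
  inducedCt⇒tildeCycle {k} (f , f-injective , ctw) = k , f , apart , edge
    where
    apart : ∀ i j → i ≢ j → ¬ Sim G (f i) (f j)
    apart i j i≢j = ≢∧2≤⇒≁ (i≢j ∘ f-injective) (CtW⇒2≤ (ctw i j i≢j))
    edge : ∀ i j → CAdj k i j → TEdge G (f i) (f j)
    edge i j adj = CtW-adjacent (ctw i j (CAdj⇒≢ adj)) adj

  Chord : ∀ {k} → Cycle k → Set
  Chord {k} c = ∃₂ λ (i j : Fin (3 + k)) →
    i ≢ j × ¬ CAdj k i j × TEdge G (vertex c (toℕ i)) (vertex c (toℕ j))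

  chord? : ∀ {k} (c : Cycle k) → Dec (Chord c)
  chord? {k} c = any? λ i → any? λ j →
    ¬? (i ≟ᶠ j) ×-dec ¬? (CAdj? k i j) ×-dec (w G (vertex c (toℕ i)) (vertex c (toℕ j)) ≟ 3)

  arc : ∀ {k} (c : Cycle k) (m k′ : ℕ) → m + (2 + k′) < 3 + k →
    TEdge G (vertex c (m + (2 + k′))) (vertex c m) → Cycle k′
  arc {k} c m k′ bound chord = record
    { vertex    = λ a → vertex c (m + a)
    ; separated = λ a<t b<t a≢b → separated c (inside a<t) (inside b<t) (a≢b ∘ +-cancelˡ-≡ m _ _)
    ; step      = λ {a} 1+a<t → subst (λ x → TEdge G (vertex c (m + a)) (vertex c x)) (≡.sym (+-suc m a))
                    (step c (subst (_< 3 + k) (+-suc m a) (inside 1+a<t)))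
    ; close     = subst (λ x → TEdge G (vertex c (m + (2 + k′))) (vertex c x)) (≡.sym (+-identityʳ m)) chord
    }
    where
    inside : ∀ {a} → a < 3 + k′ → m + a < 3 + k
    inside a<t = <-≤-trans (+-monoʳ-< m a<t) (subst (_≤ 3 + k) (≡.sym (+-suc m (2 + k′))) bound)

  shorten-ordered : ∀ {k} (c : Cycle k) (i j : Fin (3 + k)) → toℕ i < toℕ j → ¬ CAdj k i j →
    TEdge G (vertex c (toℕ j)) (vertex c (toℕ i)) → ∃ λ k′ → k′ < k × Cycle k′
  shorten-ordered {k} c i j i<j nonadj e with nonadjacent-gap i j i<j nonadj
  ... | k′ , k′<k , j≡ = k′ , k′<k ,
    arc c (toℕ i) k′ (subst (_< 3 + k) j≡ (toℕ<n j)) (subst (λ x → TEdge G (vertex c x) _) j≡ e)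

  shorten : ∀ {k} (c : Cycle k) → Chord c → ∃ λ k′ → k′ < k × Cycle k′
  shorten c (i , j , i≢j , nonadj , e) with <-cmp (toℕ i) (toℕ j)
  ... | tri< i<j _ _ = shorten-ordered c i j i<j nonadj (TEdge-sym e)
  ... | tri≈ _ i≡j _ = contradiction (toℕ-injective i≡j) i≢j
  ... | tri> _ _ j<i = shorten-ordered c j i j<i (nonadj ∘ ⊎.swap) e

  module _ (pos : ∀ x y → x ≢ y → 1 ≤ w G x y) (mu : MuLe 3 G) where

    chordless⇒inducedCt : ∀ {k} (c : Cycle k) → ¬ Chord c → HasInducedCt G k
    chordless⇒inducedCt {k} c chordless = f , f-injective , weight
      where
      f : Fin (3 + k) → Fin n
      f = vertex c ∘ toℕ
      apart : ∀ {i j} → i ≢ j → ¬ Sim G (f i) (f j)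
      apart i≢j = separated c (toℕ<n _) (toℕ<n _) (i≢j ∘ toℕ-injective)
      f-injective : Injective _≡_ _≡_ f
      f-injective {i} {j} fi≡fj = decidable-stable (i ≟ᶠ j) λ i≢j → apart i≢j (inj₁ fi≡fj)
      weight : ∀ i j → i ≢ j → CtW k i j (w G (f i) (f j))
      weight i j i≢j with CAdj? k i j
      ... | yes adj    = subst (CtW k i j) (≡.sym (cycle-edge c i j adj)) (three adj)
      ... | no nonadj = subst (CtW k i j) (≡.sym w≡2) (two nonadj)
        where
        fi≢fj : f i ≢ f j
        fi≢fj = apart i≢j ∘ inj₁
        w≡2 : w G (f i) (f j) ≡ 2
        w≡2 = ≥1∧≤3∧≢1∧≢3⇒≡2 (pos _ _ fi≢fj) (mu _ _ fi≢fj) (apart i≢j ∘ inj₂)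
          λ e → chordless (i , j , i≢j , nonadj , e)

    cycle⇒inducedCt : ∀ {k} → Cycle k → ∃ (HasInducedCt G)
    cycle⇒inducedCt {k} = <-rec (λ k → Cycle k → ∃ (HasInducedCt G)) shortest k
      where
      shortest : ∀ k → (∀ {k′} → k′ < k → Cycle k′ → ∃ (HasInducedCt G)) → Cycle k → ∃ (HasInducedCt G)
      shortest k shorter c with chord? c
      ... | no chordless = k , chordless⇒inducedCt c chordless
      ... | yes chord with shorten c chord
      ...   | k′ , k′<k , c′ = shorter k′<k c′

  module _ (mu : MuLe 3 G) (forest : TildeForest G) where

    threeSet≤8 : IsSQ 3 8 G
    threeSet≤8 S inj = subst (_≤ 8) (≡.sym (pairSum-3 λ i j → w G (S i) (S j)))
      (+-+≤8 (mu _ _ s₀≢s₁) (mu _ _ s₀≢s₂) (mu _ _ s₁≢s₂)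
        λ (e₀₁ , e₀₂ , e₁₂) → forest (tildeTriangle s₀≢s₁ s₁≢s₂ s₀≢s₂ e₀₁ e₁₂ (TEdge-sym e₀₂)))
      where
      s₀≢s₁ : S 0F ≢ S 1F
      s₀≢s₁ = (λ ()) ∘ inj
      s₀≢s₂ : S 0F ≢ S 2F
      s₀≢s₂ = (λ ()) ∘ inj
      s₁≢s₂ : S 1F ≢ S 2F
      s₁≢s₂ = (λ ()) ∘ inj

    opposite-matchings≤9 : ∀ {a b c d} → Distinct₄ a b c d → TEdge G a b → TEdge G c d →
      (w G a c + w G b d) + (w G a d + w G b c) ≤ 9
    opposite-matchings≤9 {a} {b} {c} {d} δ ab cd = bound ((w G a c ≟ 3) ⊎-dec (w G b d ≟ 3))
      where
      open Distinct₄ δ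
      noThreeInBoth : TEdge G a c ⊎ TEdge G b d → ¬ (TEdge G a d ⊎ TEdge G b c)
      noThreeInBoth (inj₁ ac) (inj₁ ad) = forest (tildeTriangle a≢c c≢d a≢d ac cd (TEdge-sym ad))
      noThreeInBoth (inj₁ ac) (inj₂ bc) = forest (tildeTriangle a≢b b≢c a≢c ab bc (TEdge-sym ac))
      noThreeInBoth (inj₂ bd) (inj₁ ad) = forest (tildeTriangle a≢b b≢d a≢d ab bd (TEdge-sym ad))
      noThreeInBoth (inj₂ bd) (inj₂ bc) = forest (tildeTriangle b≢c c≢d b≢d bc cd (TEdge-sym bd))
      bound : Dec (TEdge G a c ⊎ TEdge G b d) → (w G a c + w G b d) + (w G a d + w G b c) ≤ 9
      bound (no noThree) =
        +-+≤9 (mu _ _ a≢c) (mu _ _ b≢d) (noThree ∘ inj₁) (noThree ∘ inj₂) (mu _ _ a≢d) (mu _ _ b≢c)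
          λ (ad , bc) (2≤ac , 2≤bd) → forest (tildeSquare δ ab bc cd (TEdge-sym ad) 2≤ac 2≤bd)
      bound (yes someThree) = subst (_≤ 9) (+-comm (w G a d + w G b c) (w G a c + w G b d))
        (+-+≤9 (mu _ _ a≢d) (mu _ _ b≢c) (noThreeInBoth someThree ∘ inj₁)
          (noThreeInBoth someThree ∘ inj₂) (mu _ _ a≢c) (mu _ _ b≢d)
          λ (ac , bd) (2≤ad , 2≤bc) →
            forest (tildeSquare (swap-last δ) ab bd (TEdge-sym cd) (TEdge-sym ac) 2≤ad 2≤bc))

    fourSet≤15 : IsSQ 4 15 G
    fourSet≤15 S inj = subst (_≤ 15) (≡.sym (pairSum-4 λ i j → w G (S i) (S j)))
      (bound (full? s₀ s₁ s₂ s₃) (full? s₀ s₂ s₁ s₃) (full? s₀ s₃ s₁ s₂))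
      where
      s₀ s₁ s₂ s₃ : Fin n
      s₀ = S 0F
      s₁ = S 1F
      s₂ = S 2F
      s₃ = S 3F
      δ : Distinct₄ s₀ s₁ s₂ s₃
      δ = record
        { a≢b = (λ ()) ∘ inj ; a≢c = (λ ()) ∘ inj ; a≢d = (λ ()) ∘ inj
        ; b≢c = (λ ()) ∘ inj ; b≢d = (λ ()) ∘ inj ; c≢d = (λ ()) ∘ inj }
      open Distinct₄ δ
      m₁ m₂ m₃ : ℕ
      m₁ = w G s₀ s₁ + w G s₂ s₃
      m₂ = w G s₀ s₂ + w G s₁ s₃
      m₃ = w G s₀ s₃ + w G s₁ s₂
      full? : ∀ a b c d → Dec (TEdge G a b × TEdge G c d)
      full? a b c d = (w G a b ≟ 3) ×-dec (w G c d ≟ 3)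
      bound : Dec (TEdge G s₀ s₁ × TEdge G s₂ s₃) → Dec (TEdge G s₀ s₂ × TEdge G s₁ s₃) →
        Dec (TEdge G s₀ s₃ × TEdge G s₁ s₂) → m₁ + (m₂ + m₃) ≤ 15
      bound (yes (e₀₁ , e₂₃)) _ _ =
        +-mono-≤ (+-mono-≤ (mu _ _ a≢b) (mu _ _ c≢d)) (opposite-matchings≤9 δ e₀₁ e₂₃)
      bound (no _) (yes (e₀₂ , e₁₃)) _ = subst (_≤ 15) (x∙yz≈y∙xz m₂ m₁ m₃)
        (+-mono-≤ (+-mono-≤ (mu _ _ a≢c) (mu _ _ b≢d))
          (subst (λ x → m₁ + (w G s₀ s₃ + x) ≤ 9) (sym G s₂ s₁)
            (opposite-matchings≤9 (swap-middle δ) e₀₂ e₁₃)))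
      bound (no _) (no _) (yes (e₀₃ , e₁₂)) = subst (_≤ 15) (x∙yz≈y∙zx m₃ m₁ m₂)
        (+-mono-≤ (+-mono-≤ (mu _ _ a≢d) (mu _ _ b≢c))
          (subst₂ (λ x y → (w G s₀ s₁ + x) + (w G s₀ s₂ + y) ≤ 9) (sym G s₃ s₂) (sym G s₃ s₁)
            (opposite-matchings≤9 (swap-middle (swap-last δ)) e₀₃ e₁₂)))
      bound (no ¬full₁) (no ¬full₂) (no ¬full₃) =
        +-mono-≤ (+≤5 (mu _ _ a≢b) (mu _ _ c≢d) ¬full₁)
          (+-mono-≤ (+≤5 (mu _ _ a≢c) (mu _ _ b≢d) ¬full₂) (+≤5 (mu _ _ a≢d) (mu _ _ b≢c) ¬full₃))

lemma5p10 : (n : ℕ) → 1 ≤ n → (G : Multigraph n) → Neat G →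
    (InNC G ⇔ TildeForest G)
lemma5p10 _ _ G (pos , mu , no112 , no113 , no123) = mk⇔ NC⇒forest forest⇒NC
  where
  NC⇒forest : InNC G → TildeForest G
  NC⇒forest (_ , noInducedCt) tildeCycle =
    let (_ , c)  = fromTildeCycle G tildeCycle
        (k , ct) = cycle⇒inducedCt G pos mu c
    in noInducedCt k ct

  forest⇒NC : TildeForest G → InNC G
  forest⇒NC forest =
    ( (fourSet≤15 G mu forest , mu , threeSet≤8 G mu forest)
    , no113 ∘ HasTriangle-rotate G
    , no112 ∘ HasTriangle-rotate G
    , no123 ∘ HasTriangle-reverse G )
    , λ _ → forest ∘ inducedCt⇒tildeCycle G
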